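{- Let $a,b$ be integers with $0\leq b<2a$ and let $G=(V,E)$ be a $k$-fold circuit in the full count matroid $\mathcal{M}(a,b)$. Suppose that either $G$ is $\mathcal{M}(a,b)$-connected or $b=0$. Then $G$ is $\mathcal{M}(a,b)$-rigid.
   Context: For a multigraph $H=(V,E)$ (loops allowed), the count matroid $\mathcal{M}_{a,b}(H)$ is the matroid on $E$ in which $F\subseteq E$ is independent iff $|F'|\leq a|V(F')|-b$ for all nonempty $F'\subseteq F$, where $V(F')$ is the set of vertices incident to $F'$. $K_n^{a,b}$ is the multigraph on $n$ vertices with $\max\{a-b,0\}$ loops at each vertex and $2a-b$ parallel edges between each pair of distinct vertices; $\mathcal{M}(a,b)=\mathcal{M}_{a,b}(K_n^{a,b})$, with rank function $r_{a,b}$. Subgraphs are identified with their edge sets, and $V$ denotes the vertex set spanned by $E$. A graph $G$ is $\mathcal{M}(a,b)$-rigid if $r_{a,b}(G)=a|V(G)|-b$, and $\mathcal{M}(a,b)$-connected if the restriction of $\mathcal{M}(a,b)$ to its edge set is a connected matroid (any two edges lie in a common circuit). A cyclic set is an edge set $D$ with $r_{a,b}(D-e)=r_{a,b}(D)$ for all $e\in D$; a $k$-fold circuit is a cyclic set with $r_{a,b}(D)=|D|-k$. -}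

module Defs where

open import Data.Nat using (ℕ; _+_; _*_; _∸_; _≤_)
open import Data.Fin using (Fin) renaming (_<_ to _<ᶠ_)
open import Data.Fin.Properties using (_≟_)
open import Data.Fin.Subset using (Subset; ∣_∣)
open import Data.Vec using (tabulate)
open import Data.Bool using (Bool; _∨_)
open import Data.List using (List; []; length)
open import Data.Bool.ListAction using (any)
open import Data.List.Membership.Propositional using (_∈_)
open import Data.List.Relation.Unary.Unique.Propositional using (Unique)
open import Data.Product using (Σ; _×_)
open import Relation.Nullary using (¬_)
open import Relation.Nullary.Decidable using (⌊_⌋)
open import Relation.Binary.PropositionalEquality using (_≡_; _≢_)

-- Edges of the multigraph K_n^{a,b} (a, b natural numbers):
--  * at each vertex v, max{a-b,0} = a ∸ b loops (labelled by Fin (a ∸ b));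
--  * between each pair u < w of distinct vertices, 2a-b parallel edges
--    (labelled by Fin (2a ∸ b); under the standing assumption b < 2a this is 2a-b).
data Edge (n a b : ℕ) : Set where
  loop : (v : Fin n) → Fin (a ∸ b) → Edge n a b
  link : (u w : Fin n) → u <ᶠ w → Fin (2 * a ∸ b) → Edge n a b

-- An edge set (subgraph) is a duplicate-free list of edges of K_n^{a,b}
-- (only its membership matters); sets of edges in general are predicates.
EdgePred : ℕ → ℕ → ℕ → Set₁
EdgePred n a b = Edge n a b → Set

incident : ∀ {n a b} → Fin n → Edge n a b → Bool
incident v (loop u _)     = ⌊ v ≟ u ⌋
incident v (link u w _ _) = ⌊ v ≟ u ⌋ ∨ ⌊ v ≟ w ⌋

vertexSet : ∀ {n a b} → List (Edge n a b) → Subset n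
vertexSet F = tabulate (λ v → any (incident v) F)

nV : ∀ {n a b} → List (Edge n a b) → ℕ
nV F = ∣ vertexSet F ∣

_⊆ₚ_ : ∀ {n a b} → List (Edge n a b) → EdgePred n a b → Set
F ⊆ₚ P = ∀ {e} → e ∈ F → P e

⟦_⟧ : ∀ {n a b} → List (Edge n a b) → EdgePred n a b
⟦ F ⟧ e = e ∈ F

_∖_ : ∀ {n a b} → EdgePred n a b → Edge n a b → EdgePred n a b
(P ∖ e) x = P x × x ≢ e

-- Independence in M(a,b) = M_{a,b}(K_n^{a,b}):
-- |F'| ≤ a|V(F')| - b for all nonempty (finite) F' ⊆ F
-- (stated as |F'| + b ≤ a|V(F')| to stay in ℕ, which is the integer inequality).
Indep : ∀ {n a b} → EdgePred n a b → Set
Indep {n} {a} {b} P =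
  (F' : List (Edge n a b)) → Unique F' → F' ⊆ₚ P → F' ≢ [] →
  length F' + b ≤ a * nV F'

HasRank : ∀ {n a b} → EdgePred n a b → ℕ → Set
HasRank {n} {a} {b} P r =
  Σ (List (Edge n a b)) (λ I → Unique I × I ⊆ₚ P × Indep ⟦ I ⟧ × length I ≡ r)
  × ((I : List (Edge n a b)) → Unique I → I ⊆ₚ P → Indep ⟦ I ⟧ → length I ≤ r)

Cyclic : ∀ {n a b} → List (Edge n a b) → Set
Cyclic D = ∀ e → e ∈ D → ∀ r → HasRank ⟦ D ⟧ r → HasRank (⟦ D ⟧ ∖ e) r

KFoldCircuit : ∀ {n a b} → ℕ → List (Edge n a b) → Set
KFoldCircuit k D = Cyclic D × (∀ r → HasRank ⟦ D ⟧ r → r + k ≡ length D)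

Circuit : ∀ {n a b} → List (Edge n a b) → Set
Circuit C = ¬ Indep ⟦ C ⟧ × (∀ e → e ∈ C → Indep (⟦ C ⟧ ∖ e))

Connected : ∀ {n a b} → List (Edge n a b) → Set
Connected {n} {a} {b} E =
  ∀ e f → e ∈ E → f ∈ E →
  Σ (List (Edge n a b)) (λ C → Unique C × C ⊆ₚ ⟦ E ⟧ × Circuit C × e ∈ C × f ∈ C)

-- M(a,b)-rigid: r(G) = a|V(G)| - b  (as r + b = a|V(G)|, the integer equation)
Rigid : ∀ {n a b} → List (Edge n a b) → Set
Rigid {n} {a} {b} G = ∀ r → HasRank ⟦ G ⟧ r → r + b ≡ a * nV G

-- Rigidity comes from a spanning tight set: an independent U with ∣U∣ + b = a ∣V(U)∣ and
-- V(U) = V(G) gives a ∣V(G)∣ ≤ ∣U∣ + b ≤ r + b, while a maximum independent set gives r + b ≤ a ∣V(G)∣.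
--
-- Two tight subsets of an independent set have a tight union when they share an edge, and always when
-- b = 0; and if adding an edge f makes an independent K dependent, some tight subset of K covers the
-- endpoints of f. If b = 0, the tight subsets of a base I covering the edges outside I merge into one
-- tight A; were a base edge e not covered by A, then A, e and the part of a base of G - e not covered
-- by A would be disjoint subsets of I with more than ∣I∣ edges. If G is M(a,b)-connected, fix an edge e₀
-- and grow a tight U ∋ e₀ along a circuit C through e₀ and each further edge: extend U to a maximal
-- independent K ⊆ U ∪ C, merge U with the tight sets covering the edges of C - K (each meets U, as
-- C - e₀ is independent), and count C against the result to see that it covers all of C.

{-# OPTIONS --safe #-}
module Submission where

open import Defs
open import Data.Nat using (ℕ; zero; suc; _+_; _*_; _∸_; _≤_; _<_; z≤n; _<?_)
open import Data.Nat.Properties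
open import Algebra.Properties.CommutativeSemigroup +-commutativeSemigroup using (interchange)
open import Data.Nat.Tactic.RingSolver using (solve-∀)
open import Data.Bool using (Bool)
import Data.Bool as Bool
open import Data.Bool.Properties using (T-≡; T-∨)
open import Data.Fin using (Fin; zero; suc)
import Data.Fin.Properties as Fin
open import Data.Fin.Subset
open import Data.Fin.Subset.Properties
open import Data.Vec using ([]; _∷_; tabulate)
import Data.Vec as Vec
open import Data.Vec.Properties using (lookup⇒[]=; []=⇒lookup; lookup∘tabulate)
open import Data.List using (List; []; _∷_; length; lookup; allFin)
open import Data.List.Membership.Propositional using (find; lose) renaming (_∈_ to _∈ˡ_)
open import Data.List.Membership.Propositional.Properties using (∈-lookup; ∈-allFin)
open import Data.List.Membership.Propositional.Properties.WithK using (unique∧set⇒bag)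
open import Data.List.Relation.Binary.BagAndSetEquality using (∼bag⇒↭)
open import Data.List.Relation.Binary.Permutation.Propositional.Properties using (↭-length)
open import Data.List.Relation.Binary.Subset.Propositional using () renaming (_⊆_ to _⊆ˡ_)
import Data.List.Relation.Unary.All as All
open import Data.List.Relation.Unary.AllPairs using ([]; _∷_)
open import Data.List.Relation.Unary.Any using (here; there)
import Data.List.Relation.Unary.Any as Any
open import Data.List.Relation.Unary.Any.Properties using (any⁺; any⁻; lookup-index)
open import Data.List.Relation.Unary.Unique.Propositional using (Unique)
open import Data.Product using (_×_; _,_; proj₁; proj₂; ∃-syntax)
open import Data.Sum using (_⊎_; inj₁; inj₂; [_,_]′; map; map₁)
open import Data.Empty using (⊥-elim)
open import Function using (id; _∘_; case_of_)
open import Function.Bundles using (Equivalence; mk⇔)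
open import Relation.Nullary using (¬_; Dec; yes; no)
open import Relation.Nullary.Decidable using (_×-dec_; ⌊_⌋; fromWitness; toWitness; decidable-stable)
open import Relation.Binary.Definitions using (DecidableEquality)
open import Relation.Binary.PropositionalEquality
  using (_≡_; _≢_; refl; sym; trans; cong; cong₂; subst; subst₂)

-- Finite subsets

private variable
  k : ℕ

x∈p⇒⁅x⁆⊆p : {p : Subset k} {x : Fin k} → x ∈ p → ⁅ x ⁆ ⊆ p
x∈p⇒⁅x⁆⊆p {p = p} {x} x∈p y∈⁅x⁆ = subst (_∈ p) (sym (x∈⁅y⁆⇒x≡y x y∈⁅x⁆)) x∈p

∪-lub : {p q r : Subset k} → p ⊆ r → q ⊆ r → p ∪ q ⊆ r
∪-lub {p = p} {q} p⊆r q⊆r x∈p∪q = [ p⊆r , q⊆r ]′ (x∈p∪q⁻ p q x∈p∪q)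

x∈p─q⇒x∉q : (p q : Subset k) {x : Fin k} → x ∈ p ─ q → x ∉ q
x∈p─q⇒x∉q (s ∷ p) (outside ∷ q) Vec.here       ()
x∈p─q⇒x∉q (s ∷ p) (t ∷ q)       (Vec.there x∈) (Vec.there x∈q) = x∈p─q⇒x∉q p q x∈ x∈q

⊆⁅x⁆⇒≡⁅x⁆ : {p : Subset k} {x : Fin k} → p ⊆ ⁅ x ⁆ → Nonempty p → p ≡ ⁅ x ⁆
⊆⁅x⁆⇒≡⁅x⁆ {x = x} p⊆⁅x⁆ (y , y∈p) = ⊆-antisym p⊆⁅x⁆
  (x∈p⇒⁅x⁆⊆p (subst (_∈ _) (x∈⁅y⁆⇒x≡y x (p⊆⁅x⁆ y∈p)) y∈p))

∩-monoˡ : {p q r : Subset k} → p ⊆ q → p ∩ r ⊆ q ∩ r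
∩-monoˡ {p = p} {r = r} p⊆q x∈ = x∈p∩q⁺ (p⊆q (proj₁ (x∈p∩q⁻ p r x∈)) , proj₂ (x∈p∩q⁻ p r x∈))

Empty[p-x]⇒p⊆⁅x⁆ : {p : Subset k} {x : Fin k} → Empty (p - x) → p ⊆ ⁅ x ⁆
Empty[p-x]⇒p⊆⁅x⁆ {x = x} empty {y} y∈p with y Fin.≟ x
... | yes refl = x∈⁅x⁆ x
... | no y≢x   = ⊥-elim (empty (y , x∈p∧x≢y⇒x∈p-y y∈p y≢x))

∈-tabulate⁺ : {f : Fin k → Bool} {x : Fin k} → Bool.T (f x) → x ∈ tabulate f
∈-tabulate⁺ {f = f} {x} t =
  lookup⇒[]= x (tabulate f) (trans (lookup∘tabulate f x) (Equivalence.to T-≡ t))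

∈-tabulate⁻ : {f : Fin k → Bool} {x : Fin k} → x ∈ tabulate f → Bool.T (f x)
∈-tabulate⁻ {f = f} {x} x∈ = Equivalence.from T-≡ (trans (sym (lookup∘tabulate f x)) ([]=⇒lookup x∈))

∣p∪q∣+∣p∩q∣≡∣p∣+∣q∣ : (p q : Subset k) → ∣ p ∪ q ∣ + ∣ p ∩ q ∣ ≡ ∣ p ∣ + ∣ q ∣
∣p∪q∣+∣p∩q∣≡∣p∣+∣q∣ []            []            = refl
∣p∪q∣+∣p∩q∣≡∣p∣+∣q∣ (inside ∷ p)  (inside ∷ q)  =
  cong suc (trans (+-suc _ _) (trans (cong suc (∣p∪q∣+∣p∩q∣≡∣p∣+∣q∣ p q)) (sym (+-suc _ _))))
∣p∪q∣+∣p∩q∣≡∣p∣+∣q∣ (inside ∷ p)  (outside ∷ q) = cong suc (∣p∪q∣+∣p∩q∣≡∣p∣+∣q∣ p q)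
∣p∪q∣+∣p∩q∣≡∣p∣+∣q∣ (outside ∷ p) (inside ∷ q)  =
  trans (cong suc (∣p∪q∣+∣p∩q∣≡∣p∣+∣q∣ p q)) (sym (+-suc _ _))
∣p∪q∣+∣p∩q∣≡∣p∣+∣q∣ (outside ∷ p) (outside ∷ q) = ∣p∪q∣+∣p∩q∣≡∣p∣+∣q∣ p q

∣p∣≡∣p∩q∣+∣p─q∣ : (p q : Subset k) → ∣ p ∣ ≡ ∣ p ∩ q ∣ + ∣ p ─ q ∣
∣p∣≡∣p∩q∣+∣p─q∣ []            []            = refl
∣p∣≡∣p∩q∣+∣p─q∣ (inside ∷ p)  (inside ∷ q)  = cong suc (∣p∣≡∣p∩q∣+∣p─q∣ p q)
∣p∣≡∣p∩q∣+∣p─q∣ (inside ∷ p)  (outside ∷ q) =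
  trans (cong suc (∣p∣≡∣p∩q∣+∣p─q∣ p q)) (sym (+-suc _ _))
∣p∣≡∣p∩q∣+∣p─q∣ (outside ∷ p) (inside ∷ q)  = ∣p∣≡∣p∩q∣+∣p─q∣ p q
∣p∣≡∣p∩q∣+∣p─q∣ (outside ∷ p) (outside ∷ q) = ∣p∣≡∣p∩q∣+∣p─q∣ p q

∣Empty∣≡0 : {p : Subset k} → Empty p → ∣ p ∣ ≡ 0
∣Empty∣≡0 {k} e = trans (cong ∣_∣ (Empty-unique e)) (∣⊥∣≡0 k)

disjoint⇒∣p∪q∣≡∣p∣+∣q∣ : (p q : Subset k) → Empty (p ∩ q) → ∣ p ∪ q ∣ ≡ ∣ p ∣ + ∣ q ∣
disjoint⇒∣p∪q∣≡∣p∣+∣q∣ p q e = trans (sym (+-identityʳ _))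
  (trans (cong (∣ p ∪ q ∣ +_) (sym (∣Empty∣≡0 e))) (∣p∪q∣+∣p∩q∣≡∣p∣+∣q∣ p q))

x∉p⇒∣p∪⁅x⁆∣≡1+∣p∣ : {p : Subset k} {x : Fin k} → x ∉ p → ∣ p ∪ ⁅ x ⁆ ∣ ≡ suc ∣ p ∣
x∉p⇒∣p∪⁅x⁆∣≡1+∣p∣ {p = p} {x} x∉p =
  trans (disjoint⇒∣p∪q∣≡∣p∣+∣q∣ p ⁅ x ⁆ disjoint) (trans (cong (∣ p ∣ +_) (∣⁅x⁆∣≡1 x)) (+-comm _ 1))
  where
  disjoint : Empty (p ∩ ⁅ x ⁆)
  disjoint (y , y∈p∩⁅x⁆) with x∈p∩q⁻ p ⁅ x ⁆ y∈p∩⁅x⁆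
  ... | y∈p , y∈⁅x⁆ = x∉p (subst (_∈ p) (x∈⁅y⁆⇒x≡y x y∈⁅x⁆) y∈p)

x∈p⇒∣p∣≡1+∣p-x∣ : {p : Subset k} {x : Fin k} → x ∈ p → ∣ p ∣ ≡ suc ∣ p - x ∣
x∈p⇒∣p∣≡1+∣p-x∣ {p = p} {x} x∈p =
  trans (∣p∣≡∣p∩q∣+∣p─q∣ p ⁅ x ⁆) (cong (_+ ∣ p - x ∣) (trans (cong ∣_∣ p∩⁅x⁆≡⁅x⁆) (∣⁅x⁆∣≡1 x)))
  where
  p∩⁅x⁆≡⁅x⁆ : p ∩ ⁅ x ⁆ ≡ ⁅ x ⁆
  p∩⁅x⁆≡⁅x⁆ = ⊆-antisym (p∩q⊆q p ⁅ x ⁆) (λ y∈⁅x⁆ → x∈p∩q⁺ (x∈p⇒⁅x⁆⊆p x∈p y∈⁅x⁆ , y∈⁅x⁆))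

x∈p⇒1≤∣p∣ : {p : Subset k} {x : Fin k} → x ∈ p → 1 ≤ ∣ p ∣
x∈p⇒1≤∣p∣ {x = x} x∈p = subst (_≤ _) (∣⁅x⁆∣≡1 x) (p⊆q⇒∣p∣≤∣q∣ (x∈p⇒⁅x⁆⊆p x∈p))

x≢y⇒2≤∣p∣ : {p : Subset k} {x y : Fin k} → x ≢ y → x ∈ p → y ∈ p → 2 ≤ ∣ p ∣
x≢y⇒2≤∣p∣ {p = p} {x} {y} x≢y x∈p y∈p =
  subst (_≤ ∣ p ∣) ∣⁅x⁆∪⁅y⁆∣≡2 (p⊆q⇒∣p∣≤∣q∣ (∪-lub (x∈p⇒⁅x⁆⊆p x∈p) (x∈p⇒⁅x⁆⊆p y∈p)))
  where
  ∣⁅x⁆∪⁅y⁆∣≡2 : ∣ ⁅ x ⁆ ∪ ⁅ y ⁆ ∣ ≡ 2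
  ∣⁅x⁆∪⁅y⁆∣≡2 = trans (x∉p⇒∣p∪⁅x⁆∣≡1+∣p∣ (λ y∈⁅x⁆ → x≢y (sym (x∈⁅y⁆⇒x≡y x y∈⁅x⁆))))
                      (cong suc (∣⁅x⁆∣≡1 x))

-- Sublists selected by a subset of positions

module _ {A : Set} where

  select : (xs : List A) → Subset (length xs) → List A
  select []       []            = []
  select (x ∷ xs) (inside ∷ s)  = x ∷ select xs s
  select (x ∷ xs) (outside ∷ s) = select xs s

  length-select : (xs : List A) (s : Subset (length xs)) → length (select xs s) ≡ ∣ s ∣
  length-select []       []            = refl
  length-select (x ∷ xs) (inside ∷ s)  = cong suc (length-select xs s)
  length-select (x ∷ xs) (outside ∷ s) = length-select xs s

  select-⊤ : (xs : List A) → select xs ⊤ ≡ xs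
  select-⊤ []       = refl
  select-⊤ (x ∷ xs) = cong (x ∷_) (select-⊤ xs)

  ∈-select⁺ : (xs : List A) {s : Subset (length xs)} {i : Fin (length xs)} →
    i ∈ s → lookup xs i ∈ˡ select xs s
  ∈-select⁺ (x ∷ xs) {inside ∷ s}  Vec.here        = here refl
  ∈-select⁺ (x ∷ xs) {inside ∷ s}  (Vec.there i∈s) = there (∈-select⁺ xs i∈s)
  ∈-select⁺ (x ∷ xs) {outside ∷ s} (Vec.there i∈s) = ∈-select⁺ xs i∈s

  ∈-select⁻ : (xs : List A) {s : Subset (length xs)} {y : A} →
    y ∈ˡ select xs s → ∃[ i ] i ∈ s × lookup xs i ≡ y
  ∈-select⁻ []       {[]}         ()
  ∈-select⁻ (x ∷ xs) {inside ∷ s} (here refl) = zero , Vec.here , refl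
  ∈-select⁻ (x ∷ xs) {inside ∷ s} (there y∈) with ∈-select⁻ xs y∈
  ... | i , i∈s , eq = suc i , Vec.there i∈s , eq
  ∈-select⁻ (x ∷ xs) {outside ∷ s} y∈ with ∈-select⁻ xs y∈
  ... | i , i∈s , eq = suc i , Vec.there i∈s , eq

  select-⊆ : (xs : List A) {s : Subset (length xs)} → select xs s ⊆ˡ xs
  select-⊆ xs y∈ with ∈-select⁻ xs y∈
  ... | i , _ , refl = ∈-lookup i

  unique-select : (xs : List A) {s : Subset (length xs)} → Unique xs → Unique (select xs s)
  unique-select []       {[]}          []         = []
  unique-select (x ∷ xs) {inside ∷ s}  (x∉ ∷ u) =
    All.tabulate (λ y∈ → All.lookup x∉ (select-⊆ xs y∈)) ∷ unique-select xs u
  unique-select (x ∷ xs) {outside ∷ s} (_  ∷ u) = unique-select xs u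

  lookup-injective : {xs : List A} → Unique xs → {i j : Fin (length xs)} →
    lookup xs i ≡ lookup xs j → i ≡ j
  lookup-injective {x ∷ xs} (x∉ ∷ u) {zero}  {zero}  _  = refl
  lookup-injective {x ∷ xs} (x∉ ∷ u) {zero}  {suc j} eq = ⊥-elim (All.lookup x∉ (∈-lookup j) eq)
  lookup-injective {x ∷ xs} (x∉ ∷ u) {suc i} {zero}  eq = ⊥-elim (All.lookup x∉ (∈-lookup i) (sym eq))
  lookup-injective {x ∷ xs} (x∉ ∷ u) {suc i} {suc j} eq = cong suc (lookup-injective u eq)

  select-mono : (xs : List A) {s t : Subset (length xs)} → s ⊆ t → select xs s ⊆ˡ select xs t
  select-mono xs s⊆t y∈ with ∈-select⁻ xs y∈
  ... | i , i∈s , refl = ∈-select⁺ xs (s⊆t i∈s)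

  ∈⇒lookup : {xs : List A} {y : A} → y ∈ˡ xs → ∃[ i ] lookup xs i ≡ y
  ∈⇒lookup y∈ = Any.index y∈ , sym (lookup-index y∈)

  unique-⊆⊇⇒length≡ : {xs ys : List A} → Unique xs → Unique ys → xs ⊆ˡ ys → ys ⊆ˡ xs →
    length xs ≡ length ys
  unique-⊆⊇⇒length≡ uxs uys xs⊆ys ys⊆xs = ↭-length (∼bag⇒↭ (unique∧set⇒bag uxs uys (mk⇔ xs⊆ys ys⊆xs)))

-- Edges of K_n^{a,b}

Fin[m∸n]⇒n<m : {x y : ℕ} → Fin (x ∸ y) → y < x
Fin[m∸n]⇒n<m ℓ = m∸n≢0⇒n<m (λ eq → Fin.¬Fin0 (subst Fin eq ℓ))

module _ {n a b : ℕ} where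

  _≟ᴱ_ : DecidableEquality (Edge n a b)
  loop v ℓ ≟ᴱ loop v′ ℓ′ with v Fin.≟ v′ | ℓ Fin.≟ ℓ′
  ... | yes refl | yes refl = yes refl
  ... | no v≢v′  | _        = no λ { refl → v≢v′ refl }
  ... | yes _    | no ℓ≢ℓ′  = no λ { refl → ℓ≢ℓ′ refl }
  loop _ _ ≟ᴱ link _ _ _ _ = no λ ()
  link _ _ _ _ ≟ᴱ loop _ _ = no λ ()
  link u w u<w ℓ ≟ᴱ link u′ w′ u′<w′ ℓ′ with u Fin.≟ u′ | w Fin.≟ w′ | ℓ Fin.≟ ℓ′
  ... | yes refl | yes refl | yes refl = yes (cong (λ p → link u w p ℓ) (<-irrelevant u<w u′<w′))
  ... | no u≢u′  | _        | _        = no λ { refl → u≢u′ refl }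
  ... | yes _    | no w≢w′  | _        = no λ { refl → w≢w′ refl }
  ... | yes _    | yes _    | no ℓ≢ℓ′  = no λ { refl → ℓ≢ℓ′ refl }

  ∈-vertexSet⁺ : {F : List (Edge n a b)} {e : Edge n a b} {v : Fin n} →
    e ∈ˡ F → Bool.T (incident v e) → v ∈ vertexSet F
  ∈-vertexSet⁺ {v = v} e∈F v∼e = ∈-tabulate⁺ (any⁺ (incident v) (lose e∈F v∼e))

  ∈-vertexSet⁻ : {F : List (Edge n a b)} {v : Fin n} →
    v ∈ vertexSet F → ∃[ e ] e ∈ˡ F × Bool.T (incident v e)
  ∈-vertexSet⁻ {F} {v} v∈ = find (any⁻ (incident v) F (∈-tabulate⁻ v∈))

  vertexSet-mono : {F F′ : List (Edge n a b)} → F ⊆ˡ F′ → vertexSet F ⊆ vertexSet F′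
  vertexSet-mono F⊆F′ v∈ with ∈-vertexSet⁻ v∈
  ... | e , e∈F , v∼e = ∈-vertexSet⁺ (F⊆F′ e∈F) v∼e

  edge-bound : (e : Edge n a b) {X : Subset n} → (∀ {v} → Bool.T (incident v e) → v ∈ X) →
    1 + b ≤ a * ∣ X ∣
  edge-bound (loop u ℓ) {X} ends = begin
    1 + b      ≤⟨ Fin[m∸n]⇒n<m {a} ℓ ⟩
    a          ≡⟨ *-identityʳ a ⟨
    a * 1      ≤⟨ *-monoʳ-≤ a (x∈p⇒1≤∣p∣ (ends {u} (fromWitness refl))) ⟩
    a * ∣ X ∣  ∎
    where open ≤-Reasoning
  edge-bound e@(link u w u<w ℓ) {X} ends = begin
    1 + b      ≤⟨ Fin[m∸n]⇒n<m {2 * a} ℓ ⟩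
    2 * a      ≡⟨ *-comm 2 a ⟩
    a * 2      ≤⟨ *-monoʳ-≤ a (x≢y⇒2≤∣p∣ (Fin.<⇒≢ u<w) (ends u∼u) (ends w∼w)) ⟩
    a * ∣ X ∣  ∎
    where
    open ≤-Reasoning
    u∼u : Bool.T (incident u e)
    u∼u = Equivalence.from (T-∨ {⌊ u Fin.≟ u ⌋} {⌊ u Fin.≟ w ⌋}) (inj₁ (fromWitness refl))
    w∼w : Bool.T (incident w e)
    w∼w = Equivalence.from (T-∨ {⌊ w Fin.≟ u ⌋} {⌊ w Fin.≟ w ⌋}) (inj₂ (fromWitness refl))

-- The count matroid on the edges of G

count-exchange : {a b ci co u p q s t : ℕ} → ci + b ≤ a * p → u + co + b ≤ a * q → u + b ≡ a * s →
  p + q ≤ s + t → ci + co + b ≤ a * t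
count-exchange {a} {b} {ci} {co} {u} {p} {q} {s} {t} ci-bound u+co-bound u-tight p+q≤s+t =
  +-cancelˡ-≤ (u + b) _ _ (begin
    (u + b) + (ci + co + b)    ≡⟨ rearrange u b ci co ⟩
    (ci + b) + (u + co + b)    ≤⟨ +-mono-≤ ci-bound u+co-bound ⟩
    a * p + a * q              ≡⟨ *-distribˡ-+ a p q ⟨
    a * (p + q)                ≤⟨ *-monoʳ-≤ a p+q≤s+t ⟩
    a * (s + t)                ≡⟨ *-distribˡ-+ a s t ⟩
    a * s + a * t              ≡⟨ cong (_+ a * t) u-tight ⟨
    (u + b) + a * t            ∎)
  where
  open ≤-Reasoning
  rearrange : ∀ u b ci co → (u + b) + (ci + co + b) ≡ (ci + b) + (u + co + b)
  rearrange = solve-∀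

-- Edge sets of G are subsets of its positions, which makes independence decidable.
module CountMatroid {n a b : ℕ} (G : List (Edge n a b)) where

  EdgeSet : Set
  EdgeSet = Subset (length G)

  edge : Fin (length G) → Edge n a b
  edge = lookup G

  V : EdgeSet → Subset n
  V S = vertexSet (select G S)

  private variable
    i : Fin (length G)
    v : Fin n
    S S′ Q K U T T₁ T₂ : EdgeSet
    W : Subset n

  ∈V⁺ : i ∈ S → Bool.T (incident v (edge i)) → v ∈ V S
  ∈V⁺ i∈S v∼i = ∈-vertexSet⁺ (∈-select⁺ G i∈S) v∼i

  ∈V⁻ : v ∈ V S → ∃[ i ] i ∈ S × Bool.T (incident v (edge i))
  ∈V⁻ v∈ with ∈-vertexSet⁻ v∈
  ... | _ , e∈ , v∼e with ∈-select⁻ G e∈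
  ...   | i , i∈S , refl = i , i∈S , v∼e

  V-⋃ : (∀ {i} → i ∈ S → V ⁅ i ⁆ ⊆ W) → V S ⊆ W
  V-⋃ spanned v∈ with ∈V⁻ v∈
  ... | i , i∈S , v∼i = spanned i∈S (∈V⁺ (x∈⁅x⁆ i) v∼i)

  V-mono : S ⊆ S′ → V S ⊆ V S′
  V-mono S⊆S′ v∈ with ∈V⁻ v∈
  ... | i , i∈S , v∼i = ∈V⁺ (S⊆S′ i∈S) v∼i

  V-∪ : V (S ∪ S′) ⊆ V S ∪ V S′
  V-∪ {S} {S′} v∈ with ∈V⁻ v∈
  ... | i , i∈S∪S′ , v∼i =
    x∈p∪q⁺ (map (λ i∈S → ∈V⁺ i∈S v∼i) (λ i∈S′ → ∈V⁺ i∈S′ v∼i) (x∈p∪q⁻ S S′ i∈S∪S′))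

  V-∩ : V (S ∩ S′) ⊆ V S ∩ V S′
  V-∩ {S} {S′} v∈ = x∈p∩q⁺ (V-mono (p∩q⊆p S S′) v∈ , V-mono (p∩q⊆q S S′) v∈)

  ∣V⊥∣≡0 : ∣ V ⊥ ∣ ≡ 0
  ∣V⊥∣≡0 = ∣Empty∣≡0 λ (_ , v∈) → ∉⊥ (proj₁ (proj₂ (∈V⁻ v∈)))

  edge-sparse : (i : Fin (length G)) → 1 + b ≤ a * ∣ V ⁅ i ⁆ ∣
  edge-sparse i = edge-bound (edge i) (∈V⁺ (x∈⁅x⁆ i))

  0<a : Fin (length G) → 0 < a
  0<a i = n≢0⇒n>0 λ a≡0 → case subst (λ c → 1 + b ≤ c * ∣ V ⁅ i ⁆ ∣) a≡0 (edge-sparse i) of λ ()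

  Overfull : EdgeSet → Set
  Overfull Q = a * ∣ V Q ∣ < ∣ Q ∣ + b

  Independent : EdgeSet → Set
  Independent S = ∀ Q → Q ⊆ S → Nonempty Q → ∣ Q ∣ + b ≤ a * ∣ V Q ∣

  Tight : EdgeSet → Set
  Tight S = ∣ S ∣ + b ≡ a * ∣ V S ∣

  OverfullSubset : EdgeSet → Set
  OverfullSubset S = ∃[ Q ] Q ⊆ S × Nonempty Q × Overfull Q

  overfullSubset? : (S : EdgeSet) → Dec (OverfullSubset S)
  overfullSubset? S = anySubset? λ Q → Q ⊆? S ×-dec nonempty? Q ×-dec a * ∣ V Q ∣ <? ∣ Q ∣ + b

  no-overfullSubset⇒independent : ¬ OverfullSubset S → Independent S
  no-overfullSubset⇒independent none Q Q⊆S ne = ≮⇒≥ λ over → none (Q , Q⊆S , ne , over)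

  independent? : (S : EdgeSet) → Dec (Independent S)
  independent? S with overfullSubset? S
  ... | yes (Q , Q⊆S , ne , over) = no λ ind → <⇒≱ over (ind Q Q⊆S ne)
  ... | no none                   = yes (no-overfullSubset⇒independent none)

  dependent⇒overfullSubset : ¬ Independent S → OverfullSubset S
  dependent⇒overfullSubset {S} dep with overfullSubset? S
  ... | yes found = found
  ... | no none   = ⊥-elim (dep (no-overfullSubset⇒independent none))

  independent-⊆ : S ⊆ S′ → Independent S′ → Independent S
  independent-⊆ S⊆S′ ind Q Q⊆S = ind Q (⊆-trans Q⊆S S⊆S′)

  ⊆⁅i⁆⇒independent : S ⊆ ⁅ i ⁆ → Independent S
  ⊆⁅i⁆⇒independent {i = i} S⊆⁅i⁆ Q Q⊆S ne rewrite ⊆⁅x⁆⇒≡⁅x⁆ (⊆-trans Q⊆S S⊆⁅i⁆) ne | ∣⁅x⁆∣≡1 i =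
    edge-sparse i

  span : EdgeSet → EdgeSet
  span U = tabulate λ i → ⌊ V ⁅ i ⁆ ⊆? V U ⌋

  ∈-span⁺ : V ⁅ i ⁆ ⊆ V U → i ∈ span U
  ∈-span⁺ spanned = ∈-tabulate⁺ (fromWitness (λ {v} → spanned {v}))

  ∈-span⁻ : i ∈ span U → V ⁅ i ⁆ ⊆ V U
  ∈-span⁻ i∈ = toWitness (∈-tabulate⁻ i∈)

  ⊆span⇒V⊆ : S ⊆ span U → V S ⊆ V U
  ⊆span⇒V⊆ S⊆ = V-⋃ (λ i∈S → ∈-span⁻ (S⊆ i∈S))

  ⊆-span : U ⊆ span U
  ⊆-span i∈U = ∈-span⁺ (V-mono (x∈p⇒⁅x⁆⊆p i∈U))

  spanned-by-tight⇒≤ : Independent S → Tight U → V S ⊆ V U → ∣ S ∣ ≤ ∣ U ∣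
  spanned-by-tight⇒≤ {S} {U} ind tight VS⊆VU with nonempty? S
  ... | no empty = subst (_≤ ∣ U ∣) (sym (∣Empty∣≡0 empty)) z≤n
  ... | yes ne   = +-cancelʳ-≤ b ∣ S ∣ ∣ U ∣ (begin
    ∣ S ∣ + b    ≤⟨ ind S ⊆-refl ne ⟩
    a * ∣ V S ∣  ≤⟨ *-monoʳ-≤ a (p⊆q⇒∣p∣≤∣q∣ VS⊆VU) ⟩
    a * ∣ V U ∣  ≡⟨ tight ⟨
    ∣ U ∣ + b    ∎)
    where open ≤-Reasoning

  overfull-minus-tight : Overfull Q → i ∈ Q → Independent (Q - i) → Nonempty (Q - i) →
    Tight (Q - i) × V ⁅ i ⁆ ⊆ V (Q - i)
  overfull-minus-tight {Q} {i} over i∈Q ind ne = tight , spanned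
    where
    VQ-i⊆VQ : V (Q - i) ⊆ V Q
    VQ-i⊆VQ = V-mono (p─q⊆p Q ⁅ i ⁆)
    V⁅i⁆⊆VQ : V ⁅ i ⁆ ⊆ V Q
    V⁅i⁆⊆VQ = V-mono (x∈p⇒⁅x⁆⊆p i∈Q)
    lower : ∣ Q - i ∣ + b ≤ a * ∣ V (Q - i) ∣
    lower = ind (Q - i) ⊆-refl ne
    upper : a * ∣ V Q ∣ ≤ ∣ Q - i ∣ + b
    upper = ≤-pred (subst (λ c → a * ∣ V Q ∣ < c + b) (x∈p⇒∣p∣≡1+∣p-x∣ i∈Q) over)
    tight : Tight (Q - i)
    tight = ≤-antisym lower (≤-trans (*-monoʳ-≤ a (p⊆q⇒∣p∣≤∣q∣ VQ-i⊆VQ)) upper)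
    -- An endpoint of i outside V (Q - i) would make a * ∣ V Q ∣ exceed the tight value
    -- a * ∣ V (Q - i) ∣ by a > 0.
    spanned : V ⁅ i ⁆ ⊆ V (Q - i)
    spanned {v} v∈ = decidable-stable (v ∈? V (Q - i)) λ v∉ → <⇒≱ (begin-strict
      a * ∣ V (Q - i) ∣        <⟨ m<n+m _ (0<a i) ⟩
      a + a * ∣ V (Q - i) ∣    ≡⟨ *-suc a _ ⟨
      a * suc ∣ V (Q - i) ∣    ≤⟨ *-monoʳ-≤ a (p⊂q⇒∣p∣<∣q∣ (VQ-i⊆VQ , v , V⁅i⁆⊆VQ v∈ , v∉)) ⟩
      a * ∣ V Q ∣              ≤⟨ upper ⟩
      ∣ Q - i ∣ + b            ∎) lower
      where open ≤-Reasoning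

  Joinable : EdgeSet → EdgeSet → Set
  Joinable T₁ T₂ = Nonempty (T₁ ∩ T₂) ⊎ b ≡ 0

  tight-∪ : Independent K → T₁ ⊆ K → T₂ ⊆ K → Tight T₁ → Tight T₂ → Nonempty T₂ → Joinable T₁ T₂ →
    Tight (T₁ ∪ T₂)
  tight-∪ {K} {T₁} {T₂} indK T₁⊆K T₂⊆K tight₁ tight₂ (x , x∈T₂) joinable = ≤-antisym upper lower
    where
    open ≤-Reasoning
    upper : ∣ T₁ ∪ T₂ ∣ + b ≤ a * ∣ V (T₁ ∪ T₂) ∣
    upper = indK (T₁ ∪ T₂) (∪-lub T₁⊆K T₂⊆K) (x , q⊆p∪q T₁ T₂ x∈T₂)
    shared : ∣ T₁ ∩ T₂ ∣ + b ≤ a * ∣ V T₁ ∩ V T₂ ∣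
    shared with nonempty? (T₁ ∩ T₂)
    ... | yes ne   = ≤-trans (indK (T₁ ∩ T₂) (⊆-trans (p∩q⊆p T₁ T₂) T₁⊆K) ne)
                             (*-monoʳ-≤ a (p⊆q⇒∣p∣≤∣q∣ V-∩))
    ... | no empty = [ (λ ne → ⊥-elim (empty ne))
                     , (λ b≡0 → subst₂ (λ c d → c + d ≤ a * ∣ V T₁ ∩ V T₂ ∣)
                                       (sym (∣Empty∣≡0 empty)) (sym b≡0) z≤n)
                     ]′ joinable
    lower : a * ∣ V (T₁ ∪ T₂) ∣ ≤ ∣ T₁ ∪ T₂ ∣ + b
    lower = +-cancelʳ-≤ (a * ∣ V T₁ ∩ V T₂ ∣) _ _ (begin
      a * ∣ V (T₁ ∪ T₂) ∣ + a * ∣ V T₁ ∩ V T₂ ∣    ≤⟨ +-monoˡ-≤ _ (*-monoʳ-≤ a (p⊆q⇒∣p∣≤∣q∣ V-∪)) ⟩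
      a * ∣ V T₁ ∪ V T₂ ∣ + a * ∣ V T₁ ∩ V T₂ ∣    ≡⟨ *-distribˡ-+ a _ _ ⟨
      a * (∣ V T₁ ∪ V T₂ ∣ + ∣ V T₁ ∩ V T₂ ∣)      ≡⟨ cong (a *_) (∣p∪q∣+∣p∩q∣≡∣p∣+∣q∣ (V T₁) (V T₂)) ⟩
      a * (∣ V T₁ ∣ + ∣ V T₂ ∣)                    ≡⟨ *-distribˡ-+ a _ _ ⟩
      a * ∣ V T₁ ∣ + a * ∣ V T₂ ∣                  ≡⟨ cong₂ _+_ tight₁ tight₂ ⟨
      (∣ T₁ ∣ + b) + (∣ T₂ ∣ + b)                  ≡⟨ interchange (∣ T₁ ∣) b (∣ T₂ ∣) b ⟩
      (∣ T₁ ∣ + ∣ T₂ ∣) + (b + b)                  ≡⟨ cong (_+ (b + b)) (∣p∪q∣+∣p∩q∣≡∣p∣+∣q∣ T₁ T₂) ⟨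
      (∣ T₁ ∪ T₂ ∣ + ∣ T₁ ∩ T₂ ∣) + (b + b)        ≡⟨ interchange (∣ T₁ ∪ T₂ ∣) (∣ T₁ ∩ T₂ ∣) b b ⟩
      (∣ T₁ ∪ T₂ ∣ + b) + (∣ T₁ ∩ T₂ ∣ + b)        ≤⟨ +-monoʳ-≤ _ shared ⟩
      (∣ T₁ ∪ T₂ ∣ + b) + a * ∣ V T₁ ∩ V T₂ ∣      ∎)

  Maximal : EdgeSet → EdgeSet → Set
  Maximal K X = ∀ {i} → i ∈ X → i ∉ K → ¬ Independent (K ∪ ⁅ i ⁆)

  extend-to-maximal : {X : EdgeSet} → Independent U → U ⊆ X →
    ∃[ K ] Independent K × U ⊆ K × K ⊆ X × Maximal K X
  extend-to-maximal {U} {X} indU U⊆X =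
    let K , indK , U⊆K , K⊆X , maximal = greedy (allFin _)
    in K , indK , U⊆K , K⊆X , maximal (∈-allFin _)
    where
    Greedy : List (Fin (length G)) → Set
    Greedy L = ∃[ K ] Independent K × U ⊆ K × K ⊆ X ×
      (∀ {i} → i ∈ˡ L → i ∈ X → i ∉ K → ¬ Independent (K ∪ ⁅ i ⁆))
    greedy : ∀ L → Greedy L
    greedy [] = U , indU , ⊆-refl , U⊆X , λ ()
    greedy (j ∷ L) with greedy L
    ... | K , indK , U⊆K , K⊆X , maximal with j ∈? X | independent? (K ∪ ⁅ j ⁆)
    ...   | no j∉X  | _          = K , indK , U⊆K , K⊆X , λ
      { (here refl) j∈X → ⊥-elim (j∉X j∈X)
      ; (there i∈L)     → maximal i∈L }
    ...   | yes _   | no dep     = K , indK , U⊆K , K⊆X , λ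
      { (here refl) _ _ → dep
      ; (there i∈L)     → maximal i∈L }
    ...   | yes j∈X | yes indK+j =
      K ∪ ⁅ j ⁆ , indK+j , ⊆-trans U⊆K (p⊆p∪q ⁅ j ⁆) , ∪-lub K⊆X (x∈p⇒⁅x⁆⊆p j∈X) , λ
      { (here refl) _   j∉  → ⊥-elim (j∉ (q⊆p∪q K ⁅ j ⁆ (x∈⁅x⁆ j)))
      ; (there i∈L) i∈X i∉ → λ dep → maximal i∈L i∈X (λ i∈K → i∉ (p⊆p∪q ⁅ j ⁆ i∈K))
          (independent-⊆ (∪-lub (⊆-trans (p⊆p∪q ⁅ j ⁆) (p⊆p∪q _)) (q⊆p∪q _ _)) dep) }

  TightSpanner : EdgeSet → Fin (length G) → EdgeSet → Set
  TightSpanner K i T = T ⊆ K × Nonempty T × Tight T × V ⁅ i ⁆ ⊆ V T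

  dependent-extension⇒tight-spanner : Independent K → ¬ Independent (K ∪ ⁅ i ⁆) →
    ∃[ T ] TightSpanner K i T
  dependent-extension⇒tight-spanner {K} {i} indK dep =
    let Q , Q⊆K+i , neQ , over = dependent⇒overfullSubset dep
        Q-i⊆K : Q - i ⊆ K
        Q-i⊆K x∈ = [ id , (λ x∈⁅i⁆ → ⊥-elim (x∈p─q⇒x∉q Q ⁅ i ⁆ x∈ x∈⁅i⁆)) ]′
                     (x∈p∪q⁻ K ⁅ i ⁆ (Q⊆K+i (p─q⊆p Q ⁅ i ⁆ x∈)))
        i∈Q : i ∈ Q
        i∈Q = decidable-stable (i ∈? Q) λ i∉Q →
          <⇒≱ over (indK Q (λ x∈Q → Q-i⊆K (x∈p∧x≢y⇒x∈p-y x∈Q λ { refl → i∉Q x∈Q })) neQ)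
        neQ-i : Nonempty (Q - i)
        neQ-i = decidable-stable (nonempty? (Q - i)) λ empty →
          <⇒≱ over (⊆⁅i⁆⇒independent (Empty[p-x]⇒p⊆⁅x⁆ empty) Q ⊆-refl neQ)
        indQ-i : Independent (Q - i)
        indQ-i = independent-⊆ Q-i⊆K indK
    in Q - i , Q-i⊆K , neQ-i , overfull-minus-tight over i∈Q indQ-i neQ-i

  merge-tight : Independent K → U ⊆ K → Tight U → (D : EdgeSet) →
    (∀ {f} → f ∈ D → ∃[ T ] TightSpanner K f T × Joinable U T) →
    ∃[ A ] U ⊆ A × A ⊆ K × Tight A × (∀ {f} → f ∈ D → V ⁅ f ⁆ ⊆ V A)
  merge-tight {K} {U} indK U⊆K tightU D pieces =
    let A , U⊆A , A⊆K , tightA , spans = merge (allFin _)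
    in A , U⊆A , A⊆K , tightA , spans (∈-allFin _)
    where
    Merged : List (Fin (length G)) → Set
    Merged L = ∃[ A ] U ⊆ A × A ⊆ K × Tight A × (∀ {f} → f ∈ˡ L → f ∈ D → V ⁅ f ⁆ ⊆ V A)
    merge : ∀ L → Merged L
    merge [] = U , ⊆-refl , U⊆K , tightU , λ ()
    merge (f ∷ L) with merge L | f ∈? D
    ... | A , U⊆A , A⊆K , tightA , spans | no f∉D = A , U⊆A , A⊆K , tightA , λ
      { (here refl) f∈D → ⊥-elim (f∉D f∈D)
      ; (there g∈L)     → spans g∈L }
    ... | A , U⊆A , A⊆K , tightA , spans | yes f∈D =
      let T , (T⊆K , neT , tightT , spans-f) , joinable = pieces f∈D
          joinable′ = map₁ (λ (x , x∈) → x , ∩-monoˡ U⊆A x∈) joinable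
      in A ∪ T , ⊆-trans U⊆A (p⊆p∪q T) , ∪-lub A⊆K T⊆K ,
         tight-∪ indK A⊆K T⊆K tightA tightT neT joinable′ , λ
        { (here refl) _   → ⊆-trans spans-f (V-mono (q⊆p∪q A T))
        ; (there g∈L) g∈D → ⊆-trans (spans g∈L g∈D) (V-mono (p⊆p∪q T)) }

  IsCircuit : EdgeSet → Set
  IsCircuit C = ¬ Independent C × (∀ {i} → i ∈ C → Independent (C - i))

  circuit-overfull : {C : EdgeSet} → IsCircuit C → Overfull C
  circuit-overfull {C} (dep , minimal) =
    let Q , Q⊆C , neQ , over = dependent⇒overfullSubset dep
        C⊆Q : C ⊆ Q
        C⊆Q {i} i∈C = decidable-stable (i ∈? Q) λ i∉Q →
          <⇒≱ over (minimal i∈C Q (λ x∈Q → x∈p∧x≢y⇒x∈p-y (Q⊆C x∈Q) λ { refl → i∉Q x∈Q }) neQ)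
    in subst Overfull (⊆-antisym Q⊆C C⊆Q) over

  circuit-minus-nonempty : {C : EdgeSet} → IsCircuit C → i ∈ C → Nonempty (C - i)
  circuit-minus-nonempty {i} {C} (dep , _) i∈C = decidable-stable (nonempty? (C - i)) λ empty →
    dep (⊆⁅i⁆⇒independent (Empty[p-x]⇒p⊆⁅x⁆ empty))

  circuit-minus-tight : {C : EdgeSet} → IsCircuit C → i ∈ C → Tight (C - i)
  circuit-minus-tight circ@(_ , minimal) i∈C =
    proj₁ (overfull-minus-tight (circuit-overfull circ) i∈C (minimal i∈C)
                                (circuit-minus-nonempty circ i∈C))

  -- C - e₀ is independent and would contain T ∪ ⁅ f ⁆ if T missed U.
  tight-meets : {C : EdgeSet} {e₀ f : Fin (length G)} → IsCircuit C → e₀ ∈ U → e₀ ∈ C →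
    U ⊆ K → K ⊆ U ∪ C → f ∈ C ─ K → TightSpanner K f T → Nonempty (U ∩ T)
  tight-meets {U} {K} {T} {C} {e₀} {f} (_ , minimal) e₀∈U e₀∈C U⊆K K⊆U∪C f∈C─K
              (T⊆K , _ , tightT , spans-f) =
    decidable-stable (nonempty? (U ∩ T)) λ disjoint →
      let T⊆C-e₀ : T ⊆ C - e₀
          T⊆C-e₀ x∈T =
            let x∉U = λ x∈U → disjoint (_ , x∈p∩q⁺ (x∈U , x∈T))
                x∈C = [ (λ x∈U → ⊥-elim (x∉U x∈U)) , id ]′ (x∈p∪q⁻ U C (K⊆U∪C (T⊆K x∈T)))
            in x∈p∧x≢y⇒x∈p-y x∈C λ { refl → x∉U e₀∈U }
          f∉K = x∈p─q⇒x∉q C K f∈C─K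
          f∈C-e₀ = x∈p∧x≢y⇒x∈p-y (p─q⊆p C K f∈C─K) λ { refl → f∉K (U⊆K e₀∈U) }
          T+f⊆C-e₀ = ∪-lub T⊆C-e₀ (x∈p⇒⁅x⁆⊆p f∈C-e₀)
          V[T+f]⊆VT = ⊆-trans V-∪ (∪-lub ⊆-refl spans-f)
      in 1+n≰n (begin
        suc ∣ T ∣        ≡⟨ x∉p⇒∣p∪⁅x⁆∣≡1+∣p∣ (λ f∈T → f∉K (T⊆K f∈T)) ⟨
        ∣ T ∪ ⁅ f ⁆ ∣    ≤⟨ spanned-by-tight⇒≤ (independent-⊆ T+f⊆C-e₀ (minimal e₀∈C)) tightT V[T+f]⊆VT ⟩
        ∣ T ∣            ∎)
    where open ≤-Reasoning

  -- Otherwise, splitting C along span U and using U ∪ (C ─ span U) ⊆ K shows that C is not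
  -- overfull.
  spans-circuit : {C : EdgeSet} → IsCircuit C → Independent K → U ⊆ K → Tight U →
    (∀ {f} → f ∈ C ─ K → V ⁅ f ⁆ ⊆ V U) → V C ⊆ V U
  spans-circuit {K} {U} {C} circ@(dep , minimal) indK U⊆K tightU spans with nonempty? (C ─ span U)
  ... | no none = ⊆span⇒V⊆ λ {x} x∈C →
    decidable-stable (x ∈? span U) λ x∉ → none (x , x∈p∧x∉q⇒x∈p─q x∈C x∉)
  ... | yes (h , h∈Co) = ⊥-elim (<⇒≱ (circuit-overfull circ) C-sparse)
    where
    Ci Co : EdgeSet
    Ci = C ∩ span U
    Co = C ─ span U
    Co⊆K : Co ⊆ K
    Co⊆K {x} x∈Co = decidable-stable (x ∈? K) λ x∉K →
      x∈p─q⇒x∉q C (span U) x∈Co (∈-span⁺ (spans (x∈p∧x∉q⇒x∈p─q (p─q⊆p C (span U) x∈Co) x∉K)))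
    neCi : Nonempty Ci
    neCi = decidable-stable (nonempty? Ci) λ empty → dep (independent-⊆ (λ {x} x∈C →
      Co⊆K (x∈p∧x∉q⇒x∈p─q x∈C λ x∈span → empty (x , x∈p∩q⁺ (x∈C , x∈span)))) indK)
    Ci⊆C-h : Ci ⊆ C - h
    Ci⊆C-h x∈Ci = x∈p∧x≢y⇒x∈p-y (p∩q⊆p C (span U) x∈Ci)
      λ { refl → x∈p─q⇒x∉q C (span U) h∈Co (p∩q⊆q C (span U) x∈Ci) }
    U∩Co-empty : Empty (U ∩ Co)
    U∩Co-empty (x , x∈) = x∈p─q⇒x∉q C (span U) (p∩q⊆q U Co x∈) (⊆-span (p∩q⊆p U Co x∈))
    U∪Co-sparse : ∣ U ∣ + ∣ Co ∣ + b ≤ a * ∣ V (U ∪ Co) ∣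
    U∪Co-sparse = subst (λ c → c + b ≤ a * ∣ V (U ∪ Co) ∣) (disjoint⇒∣p∪q∣≡∣p∣+∣q∣ U Co U∩Co-empty)
      (indK (U ∪ Co) (∪-lub U⊆K Co⊆K) (h , q⊆p∪q U Co h∈Co))
    vertex-count : ∣ V Ci ∣ + ∣ V (U ∪ Co) ∣ ≤ ∣ V U ∣ + ∣ V C ∣
    vertex-count = begin
      ∣ V Ci ∣ + ∣ V (U ∪ Co) ∣      ≤⟨ +-mono-≤ (p⊆q⇒∣p∣≤∣q∣ VCi⊆VU∩VC) (p⊆q⇒∣p∣≤∣q∣ V[U∪Co]⊆VU∪VC) ⟩
      ∣ V U ∩ V C ∣ + ∣ V U ∪ V C ∣  ≡⟨ +-comm (∣ V U ∩ V C ∣) _ ⟩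
      ∣ V U ∪ V C ∣ + ∣ V U ∩ V C ∣  ≡⟨ ∣p∪q∣+∣p∩q∣≡∣p∣+∣q∣ (V U) (V C) ⟩
      ∣ V U ∣ + ∣ V C ∣              ∎
      where
      open ≤-Reasoning
      VCi⊆VU∩VC : V Ci ⊆ V U ∩ V C
      VCi⊆VU∩VC v∈ = x∈p∩q⁺ (⊆span⇒V⊆ (p∩q⊆q C (span U)) v∈ , V-mono (p∩q⊆p C (span U)) v∈)
      V[U∪Co]⊆VU∪VC : V (U ∪ Co) ⊆ V U ∪ V C
      V[U∪Co]⊆VU∪VC =
        ⊆-trans V-∪ (∪-lub (p⊆p∪q (V C)) (⊆-trans (V-mono (p─q⊆p C (span U))) (q⊆p∪q (V U) (V C))))
    C-sparse : ∣ C ∣ + b ≤ a * ∣ V C ∣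
    C-sparse = subst (λ c → c + b ≤ a * ∣ V C ∣) (sym (∣p∣≡∣p∩q∣+∣p─q∣ C (span U)))
      (count-exchange {a} {b} {∣ Ci ∣} {∣ Co ∣} {∣ U ∣} {∣ V Ci ∣} {∣ V (U ∪ Co) ∣} {∣ V U ∣} {∣ V C ∣}
        (minimal (p─q⊆p C (span U) h∈Co) Ci Ci⊆C-h neCi) U∪Co-sparse tightU vertex-count)

  grow-along-circuit : {C : EdgeSet} {e₀ : Fin (length G)} → Independent U → Tight U → e₀ ∈ U →
    IsCircuit C → e₀ ∈ C → ∃[ U′ ] Independent U′ × Tight U′ × U ⊆ U′ × V C ⊆ V U′
  grow-along-circuit {U} {C} {e₀} indU tightU e₀∈U circ e₀∈C with extend-to-maximal indU (p⊆p∪q C)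
  ... | K , indK , U⊆K , K⊆U∪C , maximal =
    let A , U⊆A , A⊆K , tightA , spans = merge-tight indK U⊆K tightU (C ─ K) piece
    in A , independent-⊆ A⊆K indK , tightA , U⊆A , spans-circuit circ indK A⊆K tightA spans
    where
    piece : ∀ {f} → f ∈ C ─ K → ∃[ T ] TightSpanner K f T × Joinable U T
    piece f∈C─K =
      let f∉K = x∈p─q⇒x∉q C K f∈C─K
          dep = maximal (q⊆p∪q U C (p─q⊆p C K f∈C─K)) f∉K
          T , spanner = dependent-extension⇒tight-spanner indK dep
      in T , spanner , inj₁ (tight-meets circ e₀∈U e₀∈C U⊆K K⊆U∪C f∈C─K spanner)

  IsRank : ℕ → Set
  IsRank r = (∃[ I ] Independent I × ∣ I ∣ ≡ r) × (∀ {S} → Independent S → ∣ S ∣ ≤ r)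

  SpanningTight : Set
  SpanningTight = ∃[ U ] Independent U × Tight U × V ⊤ ⊆ V U

  circuits⇒spanning-tight : (e₀ : Fin (length G)) → (∀ i → ∃[ C ] IsCircuit C × e₀ ∈ C × i ∈ C) →
    SpanningTight
  circuits⇒spanning-tight e₀ circuits =
    let U , indU , tightU , _ , spans = cover (allFin _)
    in U , indU , tightU , V-⋃ (λ {i} _ → spans (∈-allFin i))
    where
    Cover : List (Fin (length G)) → Set
    Cover L = ∃[ U ] Independent U × Tight U × e₀ ∈ U × (∀ {i} → i ∈ˡ L → V ⁅ i ⁆ ⊆ V U)
    cover : ∀ L → Cover L
    cover [] =
      let C , circ@(_ , minimal) , e₀∈C , _ = circuits e₀
          g , g∈C-e₀ = circuit-minus-nonempty circ e₀∈C
          g∈C = p─q⊆p C ⁅ e₀ ⁆ g∈C-e₀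
          e₀∈C-g = x∈p∧x≢y⇒x∈p-y e₀∈C λ e₀≡g →
            x∈p─q⇒x∉q C ⁅ e₀ ⁆ g∈C-e₀ (subst (_∈ ⁅ e₀ ⁆) e₀≡g (x∈⁅x⁆ e₀))
      in C - g , minimal g∈C , circuit-minus-tight circ g∈C , e₀∈C-g , λ ()
    cover (i ∷ L) =
      let U , indU , tightU , e₀∈U , spans = cover L
          C , circ , e₀∈C , i∈C = circuits i
          U′ , indU′ , tightU′ , U⊆U′ , VC⊆VU′ = grow-along-circuit indU tightU e₀∈U circ e₀∈C
      in U′ , indU′ , tightU′ , U⊆U′ e₀∈U , λ
        { (here refl) → ⊆-trans (V-mono (x∈p⇒⁅x⁆⊆p i∈C)) VC⊆VU′
        ; (there j∈L) → ⊆-trans (spans j∈L) (V-mono U⊆U′) }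

  -- If U missed an endpoint of e, then U, J ─ span U and ⁅ e ⁆ would be disjoint subsets of I
  -- with more than ∣ J ∣ elements in total.
  cyclic-edge-spanned : {I J : EdgeSet} {e : Fin (length G)} → U ⊆ I → Tight U →
    (∀ {f} → f ∉ I → V ⁅ f ⁆ ⊆ V U) → Independent J → e ∉ J → ∣ I ∣ ≤ ∣ J ∣ → V ⁅ e ⁆ ⊆ V U
  cyclic-edge-spanned {U} {I} {J} {e} U⊆I tightU spans indJ e∉J ∣I∣≤∣J∣ =
    ∈-span⁻ (decidable-stable (e ∈? span U) λ e∉span → 1+n≰n (begin
      suc (∣ U ∣ + ∣ J₂ ∣)        ≡⟨ cong suc (disjoint⇒∣p∪q∣≡∣p∣+∣q∣ U J₂ U∩J₂-empty) ⟨
      suc ∣ U ∪ J₂ ∣              ≡⟨ x∉p⇒∣p∪⁅x⁆∣≡1+∣p∣ (e∉U∪J₂ e∉span) ⟨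
      ∣ (U ∪ J₂) ∪ ⁅ e ⁆ ∣        ≤⟨ p⊆q⇒∣p∣≤∣q∣ (∪-lub (∪-lub U⊆I J₂⊆I) (x∈p⇒⁅x⁆⊆p (∉span⇒∈I e∉span))) ⟩
      ∣ I ∣                       ≤⟨ ∣I∣≤∣J∣ ⟩
      ∣ J ∣                       ≡⟨ ∣p∣≡∣p∩q∣+∣p─q∣ J (span U) ⟩
      ∣ J₁ ∣ + ∣ J₂ ∣             ≤⟨ +-monoˡ-≤ _ ∣J₁∣≤∣U∣ ⟩
      ∣ U ∣ + ∣ J₂ ∣              ∎))
    where
    open ≤-Reasoning
    J₁ J₂ : EdgeSet
    J₁ = J ∩ span U
    J₂ = J ─ span U
    ∣J₁∣≤∣U∣ : ∣ J₁ ∣ ≤ ∣ U ∣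
    ∣J₁∣≤∣U∣ =
      spanned-by-tight⇒≤ (independent-⊆ (p∩q⊆p J (span U)) indJ) tightU (⊆span⇒V⊆ (p∩q⊆q J (span U)))
    ∉span⇒∈I : ∀ {f} → f ∉ span U → f ∈ I
    ∉span⇒∈I {f} f∉span = decidable-stable (f ∈? I) λ f∉I → f∉span (∈-span⁺ (spans f∉I))
    J₂⊆I : J₂ ⊆ I
    J₂⊆I x∈J₂ = ∉span⇒∈I (x∈p─q⇒x∉q J (span U) x∈J₂)
    U∩J₂-empty : Empty (U ∩ J₂)
    U∩J₂-empty (x , x∈) = x∈p─q⇒x∉q J (span U) (p∩q⊆q U J₂ x∈) (⊆-span (p∩q⊆p U J₂ x∈))
    e∉U∪J₂ : e ∉ span U → e ∉ U ∪ J₂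
    e∉U∪J₂ e∉span e∈ = [ (λ e∈U → e∉span (⊆-span e∈U)) , (λ e∈J₂ → e∉J (p─q⊆p J (span U) e∈J₂)) ]′
      (x∈p∪q⁻ U J₂ e∈)

  cyclic⇒spanning-tight : {r : ℕ} → b ≡ 0 → IsRank r →
    (∀ e → ∃[ J ] Independent J × e ∉ J × ∣ J ∣ ≡ r) → SpanningTight
  cyclic⇒spanning-tight {r} b≡0 ((I , indI , ∣I∣≡r) , maximum) cyclic =
    let A , _ , A⊆I , tightA , spans = merge-tight indI ⊥⊆ tight-⊥ (∁ I) piece
    in A , independent-⊆ A⊆I indI , tightA , V-⋃ λ {e} _ →
         let J , indJ , e∉J , ∣J∣≡r = cyclic e
         in cyclic-edge-spanned A⊆I tightA (λ f∉I → spans (x∉p⇒x∈∁p f∉I)) indJ e∉J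
              (≤-reflexive (trans ∣I∣≡r (sym ∣J∣≡r)))
    where
    tight-⊥ : Tight ⊥
    tight-⊥ = trans (cong₂ _+_ (∣⊥∣≡0 (length G)) b≡0) (sym (trans (cong (a *_) ∣V⊥∣≡0) (*-zeroʳ a)))
    piece : ∀ {f} → f ∈ ∁ I → ∃[ T ] TightSpanner I f T × Joinable ⊥ T
    piece f∈∁I =
      let f∉I = x∈∁p⇒x∉p f∈∁I
          dep = λ ind → 1+n≰n (subst (_≤ r) (trans (x∉p⇒∣p∪⁅x⁆∣≡1+∣p∣ f∉I) (cong suc ∣I∣≡r))
                                       (maximum ind))
          T , spanner = dependent-extension⇒tight-spanner indI dep
      in T , spanner , inj₂ b≡0

  spanning-tight⇒rigid : {r : ℕ} → Fin (length G) → IsRank r → SpanningTight → r + b ≡ a * ∣ V ⊤ ∣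
  spanning-tight⇒rigid {r} e₀ ((I , indI , ∣I∣≡r) , maximum) (U , indU , tightU , spans) =
    ≤-antisym upper lower
    where
    open ≤-Reasoning
    neI : Nonempty I
    neI = decidable-stable (nonempty? I) λ empty → 1+n≰n (begin
      1             ≡⟨ ∣⁅x⁆∣≡1 e₀ ⟨
      ∣ ⁅ e₀ ⁆ ∣    ≤⟨ maximum (⊆⁅i⁆⇒independent {i = e₀} ⊆-refl) ⟩
      r             ≡⟨ ∣I∣≡r ⟨
      ∣ I ∣         ≡⟨ ∣Empty∣≡0 empty ⟩
      0             ∎)
    upper : r + b ≤ a * ∣ V ⊤ ∣
    upper = begin
      r + b         ≡⟨ cong (_+ b) ∣I∣≡r ⟨
      ∣ I ∣ + b     ≤⟨ indI I ⊆-refl neI ⟩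
      a * ∣ V I ∣   ≤⟨ *-monoʳ-≤ a (p⊆q⇒∣p∣≤∣q∣ (V-mono ⊆⊤)) ⟩
      a * ∣ V ⊤ ∣   ∎
    lower : a * ∣ V ⊤ ∣ ≤ r + b
    lower = begin
      a * ∣ V ⊤ ∣   ≤⟨ *-monoʳ-≤ a (p⊆q⇒∣p∣≤∣q∣ spans) ⟩
      a * ∣ V U ∣   ≡⟨ tightU ⟨
      ∣ U ∣ + b     ≤⟨ +-monoˡ-≤ b (maximum indU) ⟩
      r + b         ∎

-- From edge lists to subsets of positions

module FromEdgeLists {n a b : ℕ} (G : List (Edge n a b)) (uniqueG : Unique G) where

  open CountMatroid G
  open import Data.List.Membership.DecPropositional (_≟ᴱ_ {n} {a} {b}) using () renaming (_∈?_ to _∈ˡ?_)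

  mask : List (Edge n a b) → EdgeSet
  mask F = tabulate λ i → ⌊ edge i ∈ˡ? F ⌋

  ∈-mask⁺ : {F : List (Edge n a b)} {i : Fin (length G)} → edge i ∈ˡ F → i ∈ mask F
  ∈-mask⁺ e∈F = ∈-tabulate⁺ (fromWitness e∈F)

  ∈-mask⁻ : {F : List (Edge n a b)} {i : Fin (length G)} → i ∈ mask F → edge i ∈ˡ F
  ∈-mask⁻ i∈ = toWitness (∈-tabulate⁻ i∈)

  select-mask⊆ : {F : List (Edge n a b)} → select G (mask F) ⊆ˡ F
  select-mask⊆ e∈ with ∈-select⁻ G e∈
  ... | i , i∈ , refl = ∈-mask⁻ i∈

  ⊆select-mask : {F : List (Edge n a b)} → F ⊆ˡ G → F ⊆ˡ select G (mask F)
  ⊆select-mask F⊆G e∈F with ∈⇒lookup (F⊆G e∈F)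
  ... | i , refl = ∈-select⁺ G (∈-mask⁺ e∈F)

  ∣mask∣≡length : {F : List (Edge n a b)} → Unique F → F ⊆ˡ G → ∣ mask F ∣ ≡ length F
  ∣mask∣≡length {F} uniqueF F⊆G = trans (sym (length-select G (mask F)))
    (unique-⊆⊇⇒length≡ (unique-select G uniqueG) uniqueF select-mask⊆ (⊆select-mask F⊆G))

  nV≡∣V-mask∣ : {F : List (Edge n a b)} → F ⊆ˡ G → nV F ≡ ∣ V (mask F) ∣
  nV≡∣V-mask∣ F⊆G =
    cong ∣_∣ (⊆-antisym (vertexSet-mono (⊆select-mask F⊆G)) (vertexSet-mono select-mask⊆))

  independent⇒Indep : {X : EdgePred n a b} {S : EdgeSet} → Independent S →
    (∀ {e} → X e → e ∈ˡ select G S) → Indep X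
  independent⇒Indep         indS X⊆S []      _       _   []≢[] = ⊥-elim ([]≢[] refl)
  independent⇒Indep {S = S} indS X⊆S F@(e ∷ _) uniqueF F⊆X _     =
    subst₂ (λ c d → c + b ≤ a * d) (∣mask∣≡length uniqueF F⊆G) (sym (nV≡∣V-mask∣ F⊆G))
      (indS (mask F) mask⊆S (_ , ∈-mask⁺ (subst (_∈ˡ F) (sym edge-i≡e) (here refl))))
    where
    F⊆G : F ⊆ˡ G
    F⊆G e∈F = select-⊆ G (X⊆S (F⊆X e∈F))
    edge-i≡e : edge (proj₁ (∈⇒lookup (F⊆G (here refl)))) ≡ e
    edge-i≡e = proj₂ (∈⇒lookup (F⊆G (here refl)))
    mask⊆S : mask F ⊆ S
    mask⊆S i∈ with ∈-select⁻ G (X⊆S (F⊆X (∈-mask⁻ i∈)))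
    ... | j , j∈S , edge-j≡edge-i = subst (_∈ S) (lookup-injective uniqueG edge-j≡edge-i) j∈S

  Indep⇒independent : {X : EdgePred n a b} {S : EdgeSet} → Indep X →
    (∀ {e} → e ∈ˡ select G S → X e) → Independent S
  Indep⇒independent ind S⊆X Q Q⊆S (i , i∈Q) =
    subst (λ c → c + b ≤ a * ∣ V Q ∣) (length-select G Q)
      (ind (select G Q) (unique-select G uniqueG) (S⊆X ∘ select-mono G Q⊆S)
        λ select≡[] → case subst (edge i ∈ˡ_) select≡[] (∈-select⁺ G i∈Q) of λ ())

  HasRank⇒basis : {X : EdgePred n a b} {r : ℕ} → HasRank X r → (∀ {e} → X e → e ∈ˡ G) →
    ∃[ I ] Independent I × ∣ I ∣ ≡ r × (∀ {e} → e ∈ˡ select G I → X e)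
  HasRank⇒basis ((L , uniqueL , L⊆X , indL , lengthL) , _) X⊆G =
    mask L , Indep⇒independent indL select-mask⊆ , trans (∣mask∣≡length uniqueL (X⊆G ∘ L⊆X)) lengthL ,
    L⊆X ∘ select-mask⊆

  HasRank⇒IsRank : {r : ℕ} → HasRank ⟦ G ⟧ r → IsRank r
  HasRank⇒IsRank {r} hasRank@(_ , maximum) =
    let I , indI , ∣I∣≡r , _ = HasRank⇒basis hasRank id
    in (I , indI , ∣I∣≡r) , λ {S} indS → subst (_≤ r) (length-select G S)
         (maximum (select G S) (unique-select G uniqueG) (select-⊆ G) (independent⇒Indep indS id))

  Cyclic⇒avoiding-bases : {r : ℕ} → Cyclic G → HasRank ⟦ G ⟧ r →
    ∀ e → ∃[ J ] Independent J × e ∉ J × ∣ J ∣ ≡ r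
  Cyclic⇒avoiding-bases {r} cyclic hasRank e =
    let J , indJ , ∣J∣≡r , J⊆G-e = HasRank⇒basis (cyclic (edge e) (∈-lookup e) r hasRank) proj₁
    in J , indJ , (λ e∈J → proj₂ (J⊆G-e (∈-select⁺ G e∈J)) refl) , ∣J∣≡r

  Circuit⇒IsCircuit : {C : List (Edge n a b)} → C ⊆ₚ ⟦ G ⟧ → Circuit C → IsCircuit (mask C)
  Circuit⇒IsCircuit {C} C⊆G (dep , minimal) =
    (λ ind → dep (independent⇒Indep ind (⊆select-mask C⊆G))) ,
    λ {i} i∈ → Indep⇒independent (minimal (edge i) (∈-mask⁻ i∈)) (⊆C∖edge-i i)
    where
    ⊆C∖edge-i : ∀ i {e} → e ∈ˡ select G (mask C - i) → (⟦ C ⟧ ∖ edge i) e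
    ⊆C∖edge-i i e∈ with ∈-select⁻ G e∈
    ... | j , j∈ , refl = ∈-mask⁻ (p─q⊆p (mask C) ⁅ i ⁆ j∈) , λ edge-j≡edge-i →
      x∈p─q⇒x∉q (mask C) ⁅ i ⁆ j∈
        (subst (_∈ ⁅ i ⁆) (sym (lookup-injective uniqueG edge-j≡edge-i)) (x∈⁅x⁆ i))

  Connected⇒circuits : Connected G → ∀ i j → ∃[ C ] IsCircuit C × i ∈ C × j ∈ C
  Connected⇒circuits connected i j =
    let C , _ , C⊆G , circuit , i∈C , j∈C = connected (edge i) (edge j) (∈-lookup i) (∈-lookup j)
    in mask C , Circuit⇒IsCircuit C⊆G circuit , ∈-mask⁺ i∈C , ∈-mask⁺ j∈C

mainTheorem17 : (a b n k : ℕ) → b < 2 * a → 1 ≤ k →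
    (G : List (Edge n a b)) → Unique G → KFoldCircuit k G →
    Connected G ⊎ b ≡ 0 → Rigid G
mainTheorem17 a b n k _ 1≤k [] _ (_ , rank+k≡0) _ r hasRank =
  ⊥-elim (1+n≰n (≤-trans 1≤k (≤-reflexive (m+n≡0⇒n≡0 r (rank+k≡0 r hasRank)))))
mainTheorem17 a b n k _ _ G@(_ ∷ _) uniqueG (cyclic , _) connected⊎b≡0 r hasRank =
  trans (spanning-tight⇒rigid zero isRank ([ connected-case , zero-case ]′ connected⊎b≡0))
        (cong (λ F → a * nV F) (select-⊤ G))
  where
  open CountMatroid G
  open FromEdgeLists G uniqueG
  isRank : IsRank r
  isRank = HasRank⇒IsRank hasRank
  connected-case : Connected G → SpanningTight
  connected-case connected = circuits⇒spanning-tight zero (Connected⇒circuits connected zero)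
  zero-case : b ≡ 0 → SpanningTight
  zero-case b≡0 = cyclic⇒spanning-tight b≡0 isRank (Cyclic⇒avoiding-bases cyclic hasRank)
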